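{- Let $A$ be a nonnegative $n\times n$ real matrix with ppr-sequence $r_0r_1\cdots r_n$. If $r_0=0$, then $r_i=1$ for all $i=1,2,\dots,n$.
   Context: The permanent of an $m\times m$ matrix is ${\rm per}(A)=\sum_{\sigma\in S_m}\prod_{i=1}^m a_{i\sigma(i)}$. The ppr-sequence of an $n\times n$ matrix $A$ is $r_0r_1\cdots r_n$ where, for $1\le k\le n$, $r_k=1$ iff $A$ has a principal submatrix of size $k$ with nonzero permanent (else $0$), and $r_0=1$ iff $A$ has a zero entry on its main diagonal. -}

module Defs where

open import Level using (Level; _⊔_) renaming (suc to lsuc)
open import Algebra.Bundles using (CommutativeRing)
open import Relation.Binary.Structures using (IsTotalOrder)
open import Data.Nat using (ℕ; zero; suc)
open import Data.Fin using (Fin; toℕ; _<_)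
open import Data.Fin.Properties using (_≟_)
open import Data.List using (List; []; _∷_; map; concatMap; foldr; allFin; filter)
open import Data.Bool.ListAction using (and)
open import Data.Bool using (Bool; true; false; _∨_; not)
open import Data.Product using (Σ; ∃; _×_; _,_)
open import Relation.Nullary using (¬_; does)

-- An abstract model of the real numbers: a complete ordered field.
-- (All such models are isomorphic to ℝ; the standard library has no ℝ.)
record RealField (c ℓ ℓ' : Level) : Set (lsuc (c ⊔ ℓ ⊔ ℓ')) where
  field
    commRing : CommutativeRing c ℓ
  open CommutativeRing commRing public
  field
    _≤_          : Carrier → Carrier → Set ℓ'
    isTotalOrder : IsTotalOrder _≈_ _≤_
    0≉1          : ¬ (0# ≈ 1#)
    inverse      : ∀ x → ¬ (x ≈ 0#) → ∃ λ y → x * y ≈ 1#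
    +-monoˡ      : ∀ {x y} z → x ≤ y → (x + z) ≤ (y + z)
    *-nonneg     : ∀ {x y} → 0# ≤ x → 0# ≤ y → 0# ≤ (x * y)
    complete     : (P : Carrier → Set ℓ') → ∃ P →
                   (∃ λ b → ∀ x → P x → x ≤ b) →
                   ∃ λ s → (∀ x → P x → x ≤ s) ×
                           (∀ b → (∀ x → P x → x ≤ b) → s ≤ b)

module _ {c ℓ ℓ'} (R : RealField c ℓ ℓ') where
  open RealField R

  Matrix : ℕ → Set c
  Matrix n = Fin n → Fin n → Carrier

  allFuns : (m k : ℕ) → List (Fin m → Fin k)
  allFuns zero    k = (λ ()) ∷ []
  allFuns (suc m) k =
    concatMap (λ j → map (λ g → λ { Fin.zero → j ; (Fin.suc i) → g i }) (allFuns m k))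
              (allFin k)

  isInj : {m : ℕ} → (Fin m → Fin m) → Bool
  isInj {m} σ = and (concatMap (λ i → map (λ j → does (i ≟ j) ∨ not (does (σ i ≟ σ j)))
                                          (allFin m)) (allFin m))

  perms : (m : ℕ) → List (Fin m → Fin m)
  perms m = filter (λ σ → Data.Bool._≟_ (isInj σ) true) (allFuns m m)

  sumL : List Carrier → Carrier
  sumL = foldr _+_ 0#

  prodL : List Carrier → Carrier
  prodL = foldr _*_ 1#

  per : {m : ℕ} → Matrix m → Carrier
  per {m} A = sumL (map (λ σ → prodL (map (λ i → A i (σ i)) (allFin m))) (perms m))

  Nonnegative : {n : ℕ} → Matrix n → Set ℓ'
  Nonnegative {n} A = ∀ i j → 0# ≤ A i j

  StrictlyIncreasing : {k n : ℕ} → (Fin k → Fin n) → Set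
  StrictlyIncreasing f = ∀ i j → i < j → f i < f j

  principal : {k n : ℕ} → Matrix n → (Fin k → Fin n) → Matrix k
  principal A f i j = A (f i) (f j)

  -- ppr k : the proposition "r_k = 1" for the ppr-sequence r_0 … r_n of A
  ppr : {n : ℕ} → Matrix n → Fin (suc n) → Set ℓ
  ppr {n} A Fin.zero    = ∃ λ (i : Fin n) → A i i ≈ 0#
  ppr {n} A (Fin.suc k) = Σ (Fin (suc (toℕ k)) → Fin n) λ f →
                            StrictlyIncreasing f × ¬ (per (principal A f) ≈ 0#)

module Submission where

open import Defs
open import Data.Nat using (ℕ; suc)
open import Data.Fin using (Fin; zero)
open import Relation.Binary.PropositionalEquality using (_≢_)
open import Relation.Nullary using (¬_)

open import Level using (_⊔_)
import Data.Nat as ℕ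
open import Data.Fin using (toℕ; inject≤; _≟_)
open import Data.Fin.Properties using (toℕ<n; toℕ-inject≤)
open import Data.Bool using (Bool; true; _∨_; not)
open import Data.Bool.ListAction using (and)
open import Data.List using (List; []; _∷_; map; allFin)
open import Data.List.Relation.Unary.All using (All; []; _∷_; universal)
open import Data.List.Relation.Unary.All.Properties using (concat⁺; map⁺)
open import Data.List.Relation.Unary.Any as Any using (Any; here; there)
import Data.List.Relation.Unary.Any.Properties as Anyₚ
open import Data.List.Membership.Propositional.Properties using (∈-allFin)
open import Data.Product using (_×_; _,_; proj₂)
open import Data.Sum using (inj₁; inj₂)
open import Data.Empty using (⊥-elim)
open import Function using (id; Injective)
open import Relation.Nullary using (does; yes; no)
open import Relation.Binary.PropositionalEquality as ≡ using (_≡_; _≗_)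
import Relation.Binary.Structures as Structures
import Relation.Binary.Reasoning.Setoid as SetoidReasoning
import Algebra.Properties.Ring as RingProperties

-- All terms of the permanent of a nonnegative matrix are nonnegative, and the identity permutation
-- contributes the product of the diagonal, which is nonzero in a field when no diagonal entry
-- vanishes. So if r₀ = 0, every principal submatrix (e.g. the leading k × k one) has positive
-- permanent.

and≡true : {bs : List Bool} → All (_≡ true) bs → and bs ≡ true
and≡true []            = ≡.refl
and≡true (≡.refl ∷ ps) = and≡true ps

module _ {c ℓ ℓ'} (R : RealField c ℓ ℓ') where
  open RealField R hiding (zero)
  open Structures.IsTotalOrder isTotalOrder using (total; antisym; ≤-respˡ-≈; ≤-respʳ-≈)
    renaming (refl to ≤-refl; trans to ≤-trans)
  open RingProperties ring using (-1*x≈-x; -‿involutive)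

  allFuns-complete : ∀ m k (g : Fin m → Fin k) → Any (_≗ g) (allFuns R m k)
  allFuns-complete ℕ.zero    k g = here (λ ())
  allFuns-complete (suc m) k g =
    Anyₚ.concatMap⁺ _ (Any.map (λ { ≡.refl → Anyₚ.map⁺ (Any.map (λ h≗g → λ { zero → ≡.refl ; (Fin.suc i) → h≗g i })
                                                               (allFuns-complete m k (λ i → g (Fin.suc i)))) })
                               (∈-allFin (g zero)))

  isInj-complete : ∀ {m} (σ : Fin m → Fin m) → Injective _≡_ _≡_ σ → isInj R σ ≡ true
  isInj-complete {m} σ σ-inj =
    and≡true (concat⁺ (map⁺ (universal (λ i → map⁺ (universal (entry i) (allFin m))) (allFin m))))
    where
      entry : ∀ i j → (does (i ≟ j) ∨ not (does (σ i ≟ σ j))) ≡ true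
      entry i j with i ≟ j | σ i ≟ σ j
      ... | yes _  | _         = ≡.refl
      ... | no _   | no _      = ≡.refl
      ... | no i≢j | yes σi≡σj = ⊥-elim (i≢j (σ-inj σi≡σj))

  perms-complete : ∀ {m} (σ : Fin m → Fin m) → Injective _≡_ _≡_ σ → Any (_≗ σ) (perms R m)
  perms-complete {m} σ σ-inj with Anyₚ.filter⁺ (λ τ → Data.Bool._≟_ (isInj R τ) true) (allFuns-complete m m σ)
  ... | inj₁ found     = found
  ... | inj₂ not-found = ⊥-elim (not-found (isInj-complete τ τ-inj))
    where
      τ : Fin m → Fin m
      τ = Any.lookup (allFuns-complete m m σ)
      τ≗σ : τ ≗ σ
      τ≗σ = Anyₚ.lookup-result (allFuns-complete m m σ)
      τ-inj : Injective _≡_ _≡_ τ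
      τ-inj {i} {j} τi≡τj = σ-inj (≡.trans (≡.sym (τ≗σ i)) (≡.trans τi≡τj (τ≗σ j)))

  Positive : Carrier → Set (ℓ ⊔ ℓ')
  Positive x = (0# ≤ x) × ¬ (x ≈ 0#)

  0≤1 : 0# ≤ 1#
  0≤1 with total 0# 1#
  ... | inj₁ 0≤1′ = 0≤1′
  ... | inj₂ 1≤0 = ⊥-elim (0≉1 (antisym (≤-respʳ-≈ -1*-1≈1 (*-nonneg 0≤-1 0≤-1)) 1≤0))
    where
      0≤-1 : 0# ≤ (- 1#)
      0≤-1 = ≤-respˡ-≈ (-‿inverseʳ 1#) (≤-respʳ-≈ (+-identityˡ (- 1#)) (+-monoˡ (- 1#) 1≤0))
      -1*-1≈1 : - 1# * - 1# ≈ 1#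
      -1*-1≈1 = trans (-1*x≈-x (- 1#)) (-‿involutive 1#)

  nonneg+nonneg : ∀ {x y} → 0# ≤ x → 0# ≤ y → 0# ≤ (x + y)
  nonneg+nonneg {x} {y} 0≤x 0≤y = ≤-trans (≤-respʳ-≈ (sym (+-identityˡ y)) 0≤y) (+-monoˡ y 0≤x)

  nonneg+pos : ∀ {x y} → 0# ≤ x → Positive y → Positive (x + y)
  nonneg+pos {x} {y} 0≤x (0≤y , y≉0) =
    nonneg+nonneg 0≤x 0≤y ,
    λ x+y≈0 → y≉0 (antisym (≤-respʳ-≈ x+y≈0 (≤-respˡ-≈ (+-identityˡ y) (+-monoˡ y 0≤x))) 0≤y)

  pos+nonneg : ∀ {x y} → Positive x → 0# ≤ y → Positive (x + y)
  pos+nonneg {x} {y} x>0 0≤y with nonneg+pos 0≤y x>0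
  ... | 0≤y+x , y+x≉0 = ≤-respʳ-≈ (+-comm y x) 0≤y+x , λ x+y≈0 → y+x≉0 (trans (+-comm y x) x+y≈0)

  *-nonzero : ∀ {x y} → ¬ (x ≈ 0#) → ¬ (y ≈ 0#) → ¬ ((x * y) ≈ 0#)
  *-nonzero {x} {y} x≉0 y≉0 xy≈0 with inverse x x≉0
  ... | x⁻¹ , xx⁻¹≈1 = y≉0 (begin
      y             ≈⟨ sym (*-identityˡ y) ⟩
      1# * y        ≈⟨ *-congʳ (sym xx⁻¹≈1) ⟩
      (x * x⁻¹) * y ≈⟨ *-congʳ (*-comm x x⁻¹) ⟩
      (x⁻¹ * x) * y ≈⟨ *-assoc x⁻¹ x y ⟩
      x⁻¹ * (x * y) ≈⟨ *-congˡ xy≈0 ⟩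
      x⁻¹ * 0#      ≈⟨ zeroʳ x⁻¹ ⟩
      0#            ∎)
    where open SetoidReasoning setoid

  sumL-nonneg : ∀ {xs} → All (0# ≤_) xs → 0# ≤ (sumL R xs)
  sumL-nonneg []           = ≤-refl
  sumL-nonneg (0≤x ∷ 0≤xs) = nonneg+nonneg 0≤x (sumL-nonneg 0≤xs)

  sumL-pos : ∀ {xs} → All (0# ≤_) xs → Any Positive xs → Positive (sumL R xs)
  sumL-pos (_   ∷ 0≤xs) (here x>0)   = pos+nonneg x>0 (sumL-nonneg 0≤xs)
  sumL-pos (0≤x ∷ 0≤xs) (there xs>0) = nonneg+pos 0≤x (sumL-pos 0≤xs xs>0)

  prodL-nonneg : ∀ {xs} → All (0# ≤_) xs → 0# ≤ (prodL R xs)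
  prodL-nonneg []           = 0≤1
  prodL-nonneg (0≤x ∷ 0≤xs) = *-nonneg 0≤x (prodL-nonneg 0≤xs)

  prodL-pos : ∀ {xs} → All Positive xs → Positive (prodL R xs)
  prodL-pos []                 = 0≤1 , λ 1≈0 → 0≉1 (sym 1≈0)
  prodL-pos ((0≤x , x≉0) ∷ xs>0) with prodL-pos xs>0
  ... | 0≤p , p≉0 = *-nonneg 0≤x 0≤p , *-nonzero x≉0 p≉0

  per-pos : ∀ {m} (B : Matrix R m) → Nonnegative R B → (∀ i → ¬ (B i i ≈ 0#)) → Positive (per R B)
  per-pos {m} B B≥0 diag≉0 =
    sumL-pos (map⁺ (universal (λ σ → prodL-nonneg (map⁺ (universal (λ i → B≥0 i (σ i)) (allFin m)))) (perms R m)))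
             (Anyₚ.map⁺ (Any.map diagonal-term-pos (perms-complete id id)))
    where
      diagonal-term-pos : ∀ {σ} → σ ≗ id → Positive (prodL R (map (λ i → B i (σ i)) (allFin m)))
      diagonal-term-pos {σ} σ≗id = prodL-pos (map⁺ (universal entry-pos (allFin m)))
        where
          entry-pos : ∀ i → Positive (B i (σ i))
          entry-pos i = ≡.subst (λ j → Positive (B i j)) (≡.sym (σ≗id i)) (B≥0 i i , diag≉0 i)

  leading : ∀ {k n} → k ℕ.≤ n → Fin k → Fin n
  leading k≤n i = inject≤ i k≤n

  leading-strictlyIncreasing : ∀ {k n} (k≤n : k ℕ.≤ n) → StrictlyIncreasing R (leading k≤n)
  leading-strictlyIncreasing k≤n i j i<j
    rewrite toℕ-inject≤ i k≤n | toℕ-inject≤ j k≤n = i<j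

lemma3p2 : ∀ {c ℓ ℓ'} (R : RealField c ℓ ℓ') (n : ℕ) (A : Matrix R n) →
           Nonnegative R A →
           ¬ ppr R A zero →
           (i : Fin (suc n)) → i ≢ zero → ppr R A i
lemma3p2 R n A A≥0 ¬r₀ zero         0≢0 = ⊥-elim (0≢0 ≡.refl)
lemma3p2 R n A A≥0 ¬r₀ (Fin.suc k) _    =
  f , leading-strictlyIncreasing R k<n ,
  proj₂ (per-pos R (principal R A f) (λ i j → A≥0 (f i) (f j)) (λ i Afifi≈0 → ¬r₀ (f i , Afifi≈0)))
  where
    k<n : suc (toℕ k) ℕ.≤ n
    k<n = toℕ<n k
    f : Fin (suc (toℕ k)) → Fin n
    f = leading R k<n
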